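{- If $(x:U)V\le(x:U')V'$, then $U'\le U$ and $V\le V'$.
   Context: Sorts: $\mathcal S=\{\star,\Box\}$. Let $\mathcal X$ be a set of variables and $\mathcal F$ a set of symbols; a set $\mathcal R$ of rewrite rules is given, a symbol is defined if it heads the left-hand side of some rule and constant otherwise; $\mathcal{CF}^\Box$ denotes the constant symbols of sort $\Box$. Size expressions form a first-order term algebra $\mathcal A$ over size symbols and size variables, with a quasi-ordering $\le_{\mathcal A}$. Terms: $t::= s\mid x\mid C^a\mid f\mid [x:t]t\mid (x:t)t\mid tt$ with $s\in\mathcal S$, $C\in\mathcal{CF}^\Box$, $a\in\mathcal A$, $f\in\mathcal F\setminus\mathcal{CF}^\Box$. The reduction $\to$ is $\beta\cup\mathcal R$ closed under contexts and is assumed confluent; $T\downarrow U$ means $T$ and $U$ have a common reduct. Subtyping $\le$ is the smallest relation closed under: (refl) $T\le T$; (size) $C^a\vec t\le C^b\vec t$ when $C\in\mathcal{CF}^\Box$ and $a\le_{\mathcal A}b$; (prod) from $U'\le U$ and $V\le V'$ infer $(x:U)V\le(x:U')V'$; (conv) from $T'\le U'$, $T\downarrow T'$, $U'\downarrow U$ infer $T\le U$; (trans) from $T\le U$, $U\le V$ infer $T\le V$. -}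

module Defs where

open import Level using (Level; 0ℓ)
open import Data.Nat using (ℕ; zero; suc)
open import Data.Vec using (Vec; []; _∷_)
open import Data.List using (List; []; _∷_)
open import Data.Product using (Σ-syntax; _×_)
open import Relation.Binary.Construct.Closure.ReflexiveTransitive using (Star)

data Sort : Set where
  ⋆ □ : Sort

-- The symbol set F is split as the disjoint union of
--   CFBox : the constant symbols of sort □ (the set CF^□), and
--   Other : F ∖ CF^□.
record Sig : Set₁ where
  field
    SizeSym : Set
    arity   : SizeSym → ℕ
    CFBox   : Set
    Other   : Set

module _ (Sg : Sig) where
  open Sig Sg

  data SizeExpr : Set where
    svar : ℕ → SizeExpr
    sapp : (s : SizeSym) → Vec SizeExpr (arity s) → SizeExpr

  -- Terms, with de Bruijn indices for variables.
  --   lam T u  is  [x:T]u ,  pi T U  is  (x:T)U .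
  data Term : Set where
    sort  : Sort → Term
    var   : ℕ → Term
    sized : CFBox → SizeExpr → Term
    sym   : Other → Term
    lam   : Term → Term → Term
    pi    : Term → Term → Term
    app   : Term → Term → Term

  apps : Term → List Term → Term
  apps t []       = t
  apps t (u ∷ us) = apps (app t u) us

  liftR : (ℕ → ℕ) → ℕ → ℕ
  liftR ρ zero    = zero
  liftR ρ (suc n) = suc (ρ n)

  ren : (ℕ → ℕ) → Term → Term
  ren ρ (sort s)    = sort s
  ren ρ (var n)     = var (ρ n)
  ren ρ (sized C a) = sized C a
  ren ρ (sym f)     = sym f
  ren ρ (lam T u)   = lam (ren ρ T) (ren (liftR ρ) u)
  ren ρ (pi T U)    = pi (ren ρ T) (ren (liftR ρ) U)
  ren ρ (app t u)   = app (ren ρ t) (ren ρ u)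

  liftS : (ℕ → Term) → ℕ → Term
  liftS σ zero    = var zero
  liftS σ (suc n) = ren suc (σ n)

  sub : (ℕ → Term) → Term → Term
  sub σ (sort s)    = sort s
  sub σ (var n)     = σ n
  sub σ (sized C a) = sized C a
  sub σ (sym f)     = sym f
  sub σ (lam T u)   = lam (sub σ T) (sub (liftS σ) u)
  sub σ (pi T U)    = pi (sub σ T) (sub (liftS σ) U)
  sub σ (app t u)   = app (sub σ t) (sub σ u)

  single : Term → ℕ → Term
  single t zero    = t
  single t (suc n) = var n

  _[_] : Term → Term → Term
  u [ t ] = sub (single t) u

  -- A rewrite rule  f l₁ … lₙ → r ; its left-hand side is headed by the
  -- symbol f (which is then "defined").  Rule variables are de Bruijn indices.
  record Rule : Set where
    constructor mkRule
    field
      head : Other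
      args : List Term
      rhs  : Term

  lhs : Rule → Term
  lhs ρ = apps (sym (Rule.head ρ)) (Rule.args ρ)

  module _ (R : Rule → Set) where

    data _↦_ : Term → Term → Set where
      beta : ∀ T u t → app (lam T u) t ↦ (u [ t ])
      rule : ∀ ρ → R ρ → (σ : ℕ → Term) → sub σ (lhs ρ) ↦ sub σ (Rule.rhs ρ)

    data _⟶_ : Term → Term → Set where
      root  : ∀ {t u} → t ↦ u → t ⟶ u
      lamL  : ∀ {T T' u} → T ⟶ T' → lam T u ⟶ lam T' u
      lamR  : ∀ {T u u'} → u ⟶ u' → lam T u ⟶ lam T u'
      piL   : ∀ {T T' U} → T ⟶ T' → pi T U ⟶ pi T' U
      piR   : ∀ {T U U'} → U ⟶ U' → pi T U ⟶ pi T U'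
      appL  : ∀ {t t' u} → t ⟶ t' → app t u ⟶ app t' u
      appR  : ∀ {t u u'} → u ⟶ u' → app t u ⟶ app t u'

    _⟶*_ : Term → Term → Set
    _⟶*_ = Star _⟶_

    _↓_ : Term → Term → Set
    T ↓ U = Σ[ W ∈ Term ] (T ⟶* W × U ⟶* W)

    Confluent : Set
    Confluent = ∀ {t u v} → t ⟶* u → t ⟶* v → u ↓ v

    module _ (_≤A_ : SizeExpr → SizeExpr → Set) where

      data _≤_ : Term → Term → Set where
        ≤-refl  : ∀ {T} → T ≤ T
        ≤-size  : ∀ {C a b} (ts : List Term) → a ≤A b →
                  apps (sized C a) ts ≤ apps (sized C b) ts
        ≤-prod  : ∀ {U U' V V'} → U' ≤ U → V ≤ V' → pi U V ≤ pi U' V'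
        ≤-conv  : ∀ {T T' U U'} → T' ≤ U' → T ↓ T' → U' ↓ U → T ≤ U
        ≤-trans : ∀ {T U V} → T ≤ U → U ≤ V → T ≤ V

-- Up to conversion, a subtyping derivation has one of three shapes: both sides
-- are convertible, both sides convert to applications headed by a sized
-- constant, or both sides convert to products with contravariantly and
-- covariantly related components.  This invariant is preserved by every rule;
-- transitivity is the only delicate case and needs confluence, which makes
-- convertibility transitive, together with the facts that reducts of products
-- are products and reducts of sized applications are sized applications, so
-- that the second and third shapes never meet.  For two products only the
-- first and third shapes are possible, and both give the components back.
module Submission where

open import Defs
open import Data.Empty using (⊥-elim)
open import Data.List using (List; []; _∷_; map)
open import Data.Product using (_×_; _,_)
open import Relation.Binary.PropositionalEquality using (_≡_; _≢_; refl)
open import Relation.Binary.Structures using (IsPreorder)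
open import Relation.Binary.Construct.Closure.ReflexiveTransitive using (ε; _◅_; _◅◅_)
open import Relation.Nullary using (¬_)

module _ {Sg : Sig} where

  sub-apps : ∀ σ t (ts : List (Term Sg)) →
             sub Sg σ (apps Sg t ts) ≡ apps Sg (sub Sg σ t) (map (sub Sg σ) ts)
  sub-apps σ t []       = refl
  sub-apps σ t (u ∷ us) = sub-apps σ (app t u) us

  apps≡pi⇒≡pi : ∀ {t A B} (ts : List (Term Sg)) → apps Sg t ts ≡ pi A B → t ≡ pi A B
  apps≡pi⇒≡pi []       eq = eq
  apps≡pi⇒≡pi (u ∷ us) eq with apps≡pi⇒≡pi us eq
  ... | ()

  data SizeHeaded : Term Sg → Set where
    sized     : ∀ {C a} → SizeHeaded (sized C a)
    sized-app : ∀ {t u} → SizeHeaded t → SizeHeaded (app t u)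

  SizeHeaded-apps : ∀ {t} (ts : List (Term Sg)) → SizeHeaded t → SizeHeaded (apps Sg t ts)
  SizeHeaded-apps []       h = h
  SizeHeaded-apps (u ∷ us) h = SizeHeaded-apps us (sized-app h)

  SizeHeaded-apps⁻¹ : ∀ {t} (ts : List (Term Sg)) → SizeHeaded (apps Sg t ts) → SizeHeaded t
  SizeHeaded-apps⁻¹ []       h = h
  SizeHeaded-apps⁻¹ (u ∷ us) h with SizeHeaded-apps⁻¹ us h
  ... | sized-app h′ = h′

module Inversion (Sg : Sig) (R : Rule Sg → Set) where

  private
    Tm = Term Sg
    _⇒_  = _⟶_ Sg R
    _⇒*_ = _⟶*_ Sg R
    _⇓_  = _↓_ Sg R

  rule-instance≢pi : ∀ {A B} σ ρ → sub Sg σ (lhs Sg ρ) ≢ pi A B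
  rule-instance≢pi σ (mkRule f ts r) eq rewrite sub-apps σ (sym f) ts
    with apps≡pi⇒≡pi (map (sub Sg σ) ts) eq
  ... | ()

  rule-instance-¬SizeHeaded : ∀ σ ρ → ¬ SizeHeaded (sub Sg σ (lhs Sg ρ))
  rule-instance-¬SizeHeaded σ (mkRule f ts r) h rewrite sub-apps σ (sym f) ts
    with SizeHeaded-apps⁻¹ (map (sub Sg σ) ts) h
  ... | ()

  redex≢pi : ∀ {t u A B} → _↦_ Sg R t u → t ≢ pi A B
  redex≢pi (beta T u t) ()
  redex≢pi (rule ρ _ σ) = rule-instance≢pi σ ρ

  redex-¬SizeHeaded : ∀ {t u} → _↦_ Sg R t u → ¬ SizeHeaded t
  redex-¬SizeHeaded (beta T u t) (sized-app ())
  redex-¬SizeHeaded (rule ρ _ σ) = rule-instance-¬SizeHeaded σ ρ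

  SizeHeaded-⇒ : ∀ {t u} → SizeHeaded t → t ⇒ u → SizeHeaded u
  SizeHeaded-⇒ h             (root r) = ⊥-elim (redex-¬SizeHeaded r h)
  SizeHeaded-⇒ (sized-app h) (appL s) = sized-app (SizeHeaded-⇒ h s)
  SizeHeaded-⇒ (sized-app h) (appR s) = sized-app h

  SizeHeaded-⇒* : ∀ {t u} → SizeHeaded t → t ⇒* u → SizeHeaded u
  SizeHeaded-⇒* h ε        = h
  SizeHeaded-⇒* h (s ◅ ss) = SizeHeaded-⇒* (SizeHeaded-⇒ h s) ss

  data PiReduct (A B : Tm) : Tm → Set where
    pi-reduct : ∀ {A′ B′} → A ⇒* A′ → B ⇒* B′ → PiReduct A B (pi A′ B′)

  pi-⇒ : ∀ {A B W} → pi A B ⇒ W → PiReduct A B W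
  pi-⇒ (root r) = ⊥-elim (redex≢pi r refl)
  pi-⇒ (piL s)  = pi-reduct (s ◅ ε) ε
  pi-⇒ (piR s)  = pi-reduct ε (s ◅ ε)

  pi-⇒* : ∀ {A B W} → pi A B ⇒* W → PiReduct A B W
  pi-⇒* ε = pi-reduct ε ε
  pi-⇒* (s ◅ ss) with pi-⇒ s
  ... | pi-reduct a b with pi-⇒* ss
  ...   | pi-reduct a′ b′ = pi-reduct (a ◅◅ a′) (b ◅◅ b′)

  pi-⇓-pi : ∀ {A B C D} → pi A B ⇓ pi C D → A ⇓ C × B ⇓ D
  pi-⇓-pi (_ , p , q) with pi-⇒* p | pi-⇒* q
  ... | pi-reduct a b | pi-reduct c d = (_ , a , c) , (_ , b , d)

  SizeHeaded-⇓-pi : ∀ {X A B} → SizeHeaded X → ¬ (X ⇓ pi A B)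
  SizeHeaded-⇓-pi h (_ , p , q) with pi-⇒* q
  ... | pi-reduct _ _ with SizeHeaded-⇒* h p
  ...   | ()

  ⇓-refl : ∀ {T} → T ⇓ T
  ⇓-refl = _ , ε , ε

  ⇓-sym : ∀ {T U} → T ⇓ U → U ⇓ T
  ⇓-sym (W , p , q) = W , q , p

  ⇓-trans : Confluent Sg R → ∀ {T U V} → T ⇓ U → U ⇓ V → T ⇓ V
  ⇓-trans conf (_ , p , q) (_ , p′ , q′) with conf q p′
  ... | W , r , r′ = W , p ◅◅ r , q′ ◅◅ r′

  module _ (_≤A_ : SizeExpr Sg → SizeExpr Sg → Set) (conf : Confluent Sg R) where

    private
      _≼_ = _≤_ Sg R _≤A_
      _⇓∘_ : ∀ {T U V} → T ⇓ U → U ⇓ V → T ⇓ V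
      _⇓∘_ = ⇓-trans conf

    ⇓⇒≤ : ∀ {T U} → T ⇓ U → T ≼ U
    ⇓⇒≤ p = ≤-conv ≤-refl p ⇓-refl

    data _≲_ : Tm → Tm → Set where
      convertible : ∀ {T U} → T ⇓ U → T ≲ U
      size-headed : ∀ {T U X Y} → SizeHeaded X → SizeHeaded Y → T ⇓ X → U ⇓ Y → T ≲ U
      products    : ∀ {T U A B A′ B′} → T ⇓ pi A B → U ⇓ pi A′ B′ →
                    A′ ≼ A → B ≼ B′ → T ≲ U

    ≲-resp-⇓ : ∀ {T T′ U U′} → T ⇓ T′ → T′ ≲ U′ → U′ ⇓ U → T ≲ U
    ≲-resp-⇓ t (convertible p)       u = convertible (t ⇓∘ (p ⇓∘ u))
    ≲-resp-⇓ t (size-headed x y p q) u = size-headed x y (t ⇓∘ p) (⇓-sym u ⇓∘ q)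
    ≲-resp-⇓ t (products p q a b)    u = products (t ⇓∘ p) (⇓-sym u ⇓∘ q) a b

    ≲-trans : ∀ {T U V} → T ≲ U → U ≲ V → T ≲ V
    ≲-trans (convertible p) e = ≲-resp-⇓ p e ⇓-refl
    ≲-trans d (convertible q) = ≲-resp-⇓ ⇓-refl d q
    ≲-trans (size-headed x _ p _) (size-headed _ y _ q) = size-headed x y p q
    ≲-trans (size-headed _ y _ q) (products p _ _ _) =
      ⊥-elim (SizeHeaded-⇓-pi y (⇓-sym q ⇓∘ p))
    ≲-trans (products _ q _ _) (size-headed x _ p _) =
      ⊥-elim (SizeHeaded-⇓-pi x (⇓-sym p ⇓∘ q))
    ≲-trans (products p q a b) (products p′ q′ a′ b′) with pi-⇓-pi (⇓-sym q ⇓∘ p′)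
    ... | A≡ , B≡ = products p q′ (≤-trans a′ (≤-trans (⇓⇒≤ (⇓-sym A≡)) a))
                                  (≤-trans b (≤-trans (⇓⇒≤ B≡) b′))

    ≤⇒≲ : ∀ {T U} → T ≼ U → T ≲ U
    ≤⇒≲ ≤-refl         = convertible ⇓-refl
    ≤⇒≲ (≤-size ts _)  =
      size-headed (SizeHeaded-apps ts sized) (SizeHeaded-apps ts sized) ⇓-refl ⇓-refl
    ≤⇒≲ (≤-prod a b)   = products ⇓-refl ⇓-refl a b
    ≤⇒≲ (≤-conv d t u) = ≲-resp-⇓ t (≤⇒≲ d) u
    ≤⇒≲ (≤-trans d e)  = ≲-trans (≤⇒≲ d) (≤⇒≲ e)

    pi-≲-pi : ∀ {U V U′ V′} → pi U V ≲ pi U′ V′ → U′ ≼ U × V ≼ V′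
    pi-≲-pi (convertible p) with pi-⇓-pi p
    ... | U≡ , V≡ = ⇓⇒≤ (⇓-sym U≡) , ⇓⇒≤ V≡
    pi-≲-pi (size-headed x _ p _) = ⊥-elim (SizeHeaded-⇓-pi x (⇓-sym p))
    pi-≲-pi (products p q a b) with pi-⇓-pi p | pi-⇓-pi q
    ... | U≡ , V≡ | U′≡ , V′≡ = ≤-trans (⇓⇒≤ U′≡) (≤-trans a (⇓⇒≤ (⇓-sym U≡)))
                              , ≤-trans (⇓⇒≤ V≡) (≤-trans b (⇓⇒≤ (⇓-sym V′≡)))

mainTheorem3 : (Sg : Sig) (R : Rule Sg → Set)
               (_≤A_ : SizeExpr Sg → SizeExpr Sg → Set) →
               IsPreorder _≡_ _≤A_ →
               Confluent Sg R →
               ∀ {U V U' V' : Term Sg} →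
               _≤_ Sg R _≤A_ (pi U V) (pi U' V') →
               _≤_ Sg R _≤A_ U' U × _≤_ Sg R _≤A_ V V'
mainTheorem3 Sg R _≤A_ _ conf d = pi-≲-pi _≤A_ conf (≤⇒≲ _≤A_ conf d)
  where open Inversion Sg R
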